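{- Let $k\in\mathbb{N}$ with $k\ge 3$, $a\in\mathbb{Z}$, and let $\pi_2,\dots,\pi_k$ be distinct odd primes such that $\{\pi_i\}_{i=2}^k$ covers $\langle a\rangle_{\Omega(k)}$. Then there exist $b\in\mathbb{Z}$ and distinct odd primes $\pi'_2,\dots,\pi'_k$ such that $\{\pi'_i\}_{i=2}^k$ is a balanced covering of $\langle b\rangle_{\Omega(k)}$.
   Context: $p_k$ denotes the $k$-th prime ($p_1=2$). For $a\in\mathbb{Z}$, $m\in\mathbb{N}$, $\langle a\rangle_m=(a+1,\dots,a+m)$. A set of primes $\{\pi_i\}$ covers $\langle a\rangle_m$ if each $a+x$, $1\le x\le m$, is divisible by some $\pi_i$. For $k\ge 2$, $\Omega(k)$ is the maximum $m\in\mathbb{N}$ for which there exist $a\in\mathbb{Z}$ and $k-1$ distinct odd primes covering $\langle a\rangle_m$. For $k\ge3$, a covering $\{\pi_i\}_{i=2}^k$ (distinct odd primes) of $\langle a\rangle_m$ is called balanced if $m=\Omega(k)$ and for every $j\in\{2,\dots,k\}$ with $\pi_j>p_k$ there exist $x,y$ with $1\le x<y\le m$ such that $\pi_j\mid a+x$, $\pi_j\mid a+y$, and $\pi_i\nmid a+x$, $\pi_i\nmid a+y$ for all $i\in\{2,\dots,k\}$, $i\neq j$ (i.e. $\pi_j$ covers at least two positions exclusively). -}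

module Defs where

open import Data.Nat using (ℕ; zero; suc; _≤_; _<_)
open import Data.Nat.Primality using (Prime; prime?)
open import Data.Nat.Divisibility as ℕ using ()
open import Data.Integer using (ℤ; +_; _+_)
open import Data.Integer.Divisibility using (_∣_)
open import Data.Fin using (Fin)
open import Data.List using (length; filter; upTo)
open import Data.Product using (Σ; _×_; ∃; ∃-syntax)
open import Relation.Nullary using (¬_)
open import Relation.Binary.PropositionalEquality using (_≡_; _≢_)
open import Function.Definitions using (Injective)

OddPrime : ℕ → Set
OddPrime p = Prime p × ¬ (2 ℕ.∣ p)

primeCount : ℕ → ℕ
primeCount n = length (filter prime? (upTo (suc n)))

-- p is the k-th prime p_k (p_1 = 2)
IsKthPrime : ℕ → ℕ → Set
IsKthPrime k p = Prime p × primeCount p ≡ k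

-- A family of primes indexed by Fin n (index i ↔ π_{i+2}), integers a+1..a+m.
-- π covers ⟨a⟩_m : every a+x (1 ≤ x ≤ m) is divisible by some π i.
Covers : {n : ℕ} → (Fin n → ℕ) → ℤ → ℕ → Set
Covers {n} π a m = (x : ℕ) → 1 ≤ x → x ≤ m → ∃[ i ] ((+ π i) ∣ (a + + x))

DistinctOddPrimes : {n : ℕ} → (Fin n → ℕ) → Set
DistinctOddPrimes π = Injective _≡_ _≡_ π × (∀ i → OddPrime (π i))

Achievable : ℕ → ℕ → Set
Achievable k m = ∃[ a ] Σ (Fin (k ∸ 1) → ℕ) (λ π → DistinctOddPrimes π × Covers π a m)
  where open Data.Nat using (_∸_)

IsΩ : ℕ → ℕ → Set
IsΩ k m = Achievable k m × (∀ m' → Achievable k m' → m' ≤ m)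

Balanced : (k : ℕ) → {n : ℕ} → (Fin n → ℕ) → ℤ → ℕ → Set
Balanced k {n} π a m =
  Covers π a m × IsΩ k m ×
  (∀ (j : Fin n) (pk : ℕ) → IsKthPrime k pk → pk < π j →
     ∃[ x ] ∃[ y ] (1 ≤ x × x < y × y ≤ m ×
       (+ π j) ∣ (a + + x) × (+ π j) ∣ (a + + y) ×
       (∀ i → i ≢ j → ¬ ((+ π i) ∣ (a + + x)) × ¬ ((+ π i) ∣ (a + + y)))))

module Submission where

-- Start from any covering of ⟨a⟩_m by k-1 distinct odd primes,
-- m = Ω(k).  Call π_j "bad" if π_j > p_k but π_j is the only prime of the
-- family dividing at most one of the numbers a+1,…,a+m.  A bad π_j can be
-- exchanged for a smaller prime:
--   * counting: there are k-1 odd primes ≤ p_k, but only k-2 family members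
--     other than π_j, so some odd prime q ≤ p_k < π_j is not in the family;
--   * shifting: a ↦ a + t·P, P the product of the other primes, keeps every
--     position covered by those primes, and by the Chinese remainder theorem
--     t can be chosen so that q divides the (at most one) position that only
--     π_j covered.
-- The sum of the primes strictly decreases, so after finitely many exchanges
-- no bad prime remains, i.e. the covering is balanced.

open import Defs
open import Data.Nat using (ℕ; _≤_; _∸_)
open import Data.Integer using (ℤ)
open import Data.Fin using (Fin)
open import Data.Product using (Σ; _×_; ∃; ∃-syntax)

open import Data.Nat as ℕ using (suc; _<_; s≤s; z≤n)
open import Data.Nat.Properties
  using (≤-trans; ≤-reflexive; ≤-pred; <⇒≤; <-irrefl; <-cmp; ≤-<-trans; <⇒≢;
         +-monoˡ-<; +-monoʳ-<; anyUpTo?)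
open import Data.Nat.Divisibility using (_∣?_; ∣1⇒≡1)
  renaming (_∣_ to _∣ℕ_)
open import Data.Nat.Primality using (Prime; prime?; ¬prime[1]; euclidsLemma; prime⇒irreducible)
open import Data.Nat.Coprimality using (Coprime; coprime-Bézout)
open import Data.Nat.GCD using (module Bézout)
open import Data.Nat.ListAction using (sum; product)
open import Data.Nat.ListAction.Properties using (∈⇒∣product)
open import Data.Nat.Induction using (<-wellFounded)
open import Induction.WellFounded using (Acc; acc)
open import Data.Integer using (+_; 1ℤ; _+_; _*_; _-_; -_; ∣_∣)
open import Data.Integer.Properties using (pos-+; pos-*)
open import Data.Integer.Divisibility renaming (_∣_ to _∣ℤ_)
import Data.Integer.Divisibility.Signed as Signed
open import Data.Integer.Tactic.RingSolver using (solve-∀)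
open import Data.Fin using (zero; suc; punchIn; punchOut)
open import Data.Fin.Properties using (_≟_; any?; all?; punchIn-punchOut)
open import Data.Vec.Functional as Vector using (toList; removeAt; updateAt)
open import Data.Vec.Functional.Properties using (updateAt-updates; updateAt-minimal)
open import Data.List using (List; []; _∷_; length; filter; upTo)
open import Data.List.Membership.Propositional using (_∈_)
open import Data.List.Membership.Propositional.Properties using (∈-filter⁻; ∈-upTo⁻; ∈-tabulate⁺)
open import Data.List.Relation.Unary.Any using (Any; here; there)
open import Data.List.Relation.Unary.Any.Properties using (tabulate⁻)
import Data.List.Relation.Unary.All as All
open import Data.List.Relation.Unary.AllPairs using ([]; _∷_)
open import Data.List.Relation.Unary.Unique.Propositional using (Unique)
open import Data.List.Relation.Unary.Unique.Propositional.Properties using (filter⁺; upTo⁺)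
open import Data.Product using (_,_; proj₁; proj₂)
open import Data.Sum using (_⊎_; inj₁; inj₂)
open import Data.Empty using (⊥-elim)
open import Function using (_∘_; const)
open import Function.Definitions using (Injective)
open import Relation.Nullary using (Dec; yes; no; ¬_; contradiction)
open import Relation.Nullary.Decidable using (_×-dec_; _→-dec_; ¬?; map′; decidable-stable)
open import Relation.Binary.PropositionalEquality using (_≡_; _≢_; refl; sym; trans; cong; subst; module ≡-Reasoning)
open import Relation.Binary.Definitions using (tri<; tri≈; tri>)

prime∣prime⇒≡ : ∀ {p q} → Prime p → Prime q → q ∣ℕ p → q ≡ p
prime∣prime⇒≡ pp pq q∣p with prime⇒irreducible pp q∣p
... | inj₁ refl = contradiction pq ¬prime[1]
... | inj₂ q≡p = q≡p

prime∣product⇒∣factor : ∀ {p} ns → Prime p → p ∣ℕ product ns → Any (p ∣ℕ_) ns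
prime∣product⇒∣factor []       pp p∣1 = contradiction (subst Prime (∣1⇒≡1 p∣1) pp) ¬prime[1]
prime∣product⇒∣factor (n ∷ ns) pp p∣nns with euclidsLemma n (product ns) pp p∣nns
... | inj₁ p∣n  = here p∣n
... | inj₂ p∣ns = there (prime∣product⇒∣factor ns pp p∣ns)

oddPrime? : (p : ℕ) → Dec (OddPrime p)
oddPrime? p = prime? p ×-dec ¬? (2 ∣? p)

prime∧¬odd⇒≡2 : ∀ {p} → Prime p → ¬ OddPrime p → p ≡ 2
prime∧¬odd⇒≡2 {p} pp ¬odd with prime⇒irreducible pp (decidable-stable (2 ∣? p) (λ 2∤p → ¬odd (pp , 2∤p)))
... | inj₁ ()
... | inj₂ 2≡p = sym 2≡p

-- The product of all members of a family except the j-th one; shifting the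
-- start of an interval by a multiple of it preserves divisibility by the others.
cofactor : ∀ {n} → (Fin (suc n) → ℕ) → Fin (suc n) → ℕ
cofactor π j = product (toList (removeAt π j))

∣cofactor : ∀ {n} (π : Fin (suc n) → ℕ) {i j} → i ≢ j → π i ∣ℕ cofactor π j
∣cofactor π {i} {j} i≢j =
  subst (_∣ℕ cofactor π j) (cong π (punchIn-punchOut j≢i)) (∈⇒∣product (∈-tabulate⁺ (punchOut j≢i)))
  where
  j≢i : j ≢ i
  j≢i = i≢j ∘ sym

fresh∤cofactor : ∀ {n} (π : Fin (suc n) → ℕ) j {q} → (∀ i → Prime (π i)) → Prime q →
                 (∀ i → π i ≢ q) → ¬ q ∣ℕ cofactor π j
fresh∤cofactor π j primes pq fresh q∣P
  with i , q∣πi ← tabulate⁻ (prime∣product⇒∣factor (toList (removeAt π j)) pq q∣P)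
  = fresh (punchIn j i) (sym (prime∣prime⇒≡ (primes (punchIn j i)) pq q∣πi))

prime∤⇒coprime : ∀ {q P} → Prime q → ¬ q ∣ℕ P → Coprime q P
prime∤⇒coprime pq q∤P (d∣q , d∣P) with prime⇒irreducible pq d∣q
... | inj₁ d≡1 = d≡1
... | inj₂ refl = contradiction d∣P q∤P

pos-+* : ∀ a b c → + a + + b * + c ≡ + (a ℕ.+ b ℕ.* c)
pos-+* a b c = trans (cong (λ z → + a + z) (sym (pos-* b c))) (sym (pos-+ a (b ℕ.* c)))

inverse : ∀ {q P} → Prime q → ¬ q ∣ℕ P → ∃[ u ] (+ q) Signed.∣ (1ℤ + u * + P)
inverse {q} {P} pq q∤P with coprime-Bézout (prime∤⇒coprime pq q∤P)
... | Bézout.+- x y eq = + y , Signed.divides (+ x) (begin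
  1ℤ + + y * + P      ≡⟨ pos-+* 1 y P ⟩
  + (1 ℕ.+ y ℕ.* P)   ≡⟨ cong +_ eq ⟩
  + (x ℕ.* q)         ≡⟨ pos-* x q ⟩
  + x * + q           ∎)
  where open ≡-Reasoning
... | Bézout.-+ x y eq = - + y , Signed.divides (- + x) (begin
  1ℤ + (- + y) * + P         ≡⟨ negate-product 1ℤ (+ y) (+ P) ⟩
  1ℤ - + y * + P             ≡⟨ cong (λ z → 1ℤ - z) (trans (sym (pos-* y P)) (cong +_ (sym eq))) ⟩
  1ℤ - + (1 ℕ.+ x ℕ.* q)     ≡⟨ cong (λ z → 1ℤ - z) (pos-+* 1 x q) ⟨
  1ℤ - (1ℤ + + x * + q)      ≡⟨ cancel-one (+ x) (+ q) ⟩
  (- + x) * + q              ∎)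
  where
  open ≡-Reasoning
  negate-product : ∀ a b c → a + (- b) * c ≡ a - b * c
  negate-product = solve-∀
  cancel-one : ∀ a b → 1ℤ - (1ℤ + a * b) ≡ (- a) * b
  cancel-one = solve-∀

solveCongruence : ∀ {q P} → Prime q → ¬ q ∣ℕ P → ∀ c → ∃[ t ] (+ q) Signed.∣ (c + t * + P)
solveCongruence {q} {P} pq q∤P c with u , q∣1+uP ← inverse pq q∤P =
  c * u , subst (+ q Signed.∣_) (sym (factor c u (+ P))) (Signed.∣n⇒∣m*n c q∣1+uP)
  where
  factor : ∀ a b d → a + (a * b) * d ≡ a * (1ℤ + b * d)
  factor = solve-∀

shift-rearrange : ∀ b t P x → (b + x) + t * P ≡ (b + t * P) + x
shift-rearrange = solve-∀

shift-∣ : ∀ {d P} b t x → d ∣ℕ P → (+ d) ∣ℤ (b + + x) → (+ d) ∣ℤ ((b + t * + P) + + x)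
shift-∣ {d} {P} b t x d∣P d∣b+x =
  Signed.∣⇒∣ᵤ {k = + d} (subst (+ d Signed.∣_) (shift-rearrange b t (+ P) (+ x))
    (Signed.∣m∣n⇒∣m+n (Signed.∣ᵤ⇒∣ {i = b + + x} d∣b+x)
                      (Signed.∣n⇒∣m*n t (Signed.∣ᵤ⇒∣ {i = + P} d∣P))))

-- The sum of a family, the termination measure of the exchange process.
total : ∀ {n} → (Fin n → ℕ) → ℕ
total π = sum (toList π)

total-updateAt-< : ∀ {n} (xs : Fin n → ℕ) j {f : ℕ → ℕ} → f (xs j) < xs j →
                   total (updateAt xs j f) < total xs
total-updateAt-< {suc n} xs zero    lt = +-monoˡ-< (total (Vector.tail xs)) lt
total-updateAt-< {suc n} xs (suc j) lt = +-monoʳ-< (xs zero) (total-updateAt-< (Vector.tail xs) j lt)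

unique-length≤ : ∀ {A : Set} {s} (xs : List A) → Unique xs → (g : Fin s → A) →
                 (∀ {x} → x ∈ xs → ∃[ i ] g i ≡ x) → length xs ≤ s
unique-length≤ []       _ g covered = z≤n
unique-length≤ {s = ℕ.zero} (x ∷ xs) _ g covered with () ← covered (here refl)
unique-length≤ {s = suc s} (x ∷ xs) (x∉xs ∷ uniq) g covered with i₀ , gi₀≡x ← covered (here refl) =
  s≤s (unique-length≤ xs uniq (g ∘ punchIn i₀) coveredRest)
  where
  coveredRest : ∀ {y} → y ∈ xs → ∃[ i ] g (punchIn i₀ i) ≡ y
  coveredRest y∈xs with i , gi≡y ← covered (there y∈xs) =
    punchOut i₀≢i , trans (cong g (punchIn-punchOut i₀≢i)) gi≡y
    where
    i₀≢i : i₀ ≢ i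
    i₀≢i refl = All.lookup x∉xs y∈xs (trans (sym gi₀≡x) gi≡y)

missingOddPrime : ∀ {n} (g : Fin n → ℕ) N → suc (suc n) ≤ primeCount N →
                  ∃[ q ] (OddPrime q × q ≤ N × (∀ i → g i ≢ q))
missingOddPrime {n} g N many with anyUpTo? (λ q → oddPrime? q ×-dec ¬? (any? (λ i → g i ℕ.≟ q))) (suc N)
... | yes (q , q<1+N , oq , q∉g) = q , oq , ≤-pred q<1+N , λ i gi≡q → q∉g (i , gi≡q)
... | no none = contradiction (≤-trans many fewPrimes) (<-irrefl refl)
  where
  primes : List ℕ
  primes = filter prime? (upTo (suc N))
  inImage : ∀ {x} → x ∈ primes → ∃[ i ] (2 Vector.∷ g) i ≡ x
  inImage {x} x∈primes with x∈upTo , px ← ∈-filter⁻ prime? {xs = upTo (suc N)} x∈primes with oddPrime? x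
  ... | no ¬odd = zero , sym (prime∧¬odd⇒≡2 px ¬odd)
  ... | yes ox with any? (λ i → g i ℕ.≟ x)
  ...   | yes (i , gi≡x) = suc i , gi≡x
  ...   | no x∉g = ⊥-elim (none (x , ∈-upTo⁻ x∈upTo , ox , x∉g))
  fewPrimes : primeCount N ≤ suc n
  fewPrimes = unique-length≤ primes (filter⁺ prime? (upTo⁺ (suc N))) (2 Vector.∷ g) inImage

-- Coverings of ⟨b⟩_m by a family of k-1 = n+1 primes.
module _ {n : ℕ} (m : ℕ) where

  Family : Set
  Family = Fin (suc n) → ℕ

  _∣?ℤ_ : ∀ p z → Dec ((+ p) ∣ℤ z)
  p ∣?ℤ z = p ∣? ∣ z ∣

  Exclusive : Family → ℤ → Fin (suc n) → ℕ → Set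
  Exclusive π b j x = ∀ i → i ≢ j → ¬ ((+ π i) ∣ℤ (b + + x))

  exclusive? : ∀ π b j x → Dec (Exclusive π b j x)
  exclusive? π b j x = all? (λ i → ¬? (i ≟ j) →-dec ¬? (π i ∣?ℤ (b + + x)))

  ExclusivePair : Family → ℤ → Fin (suc n) → ℕ → ℕ → Set
  ExclusivePair π b j x y = 1 ≤ x × x < y × y ≤ m ×
    (+ π j) ∣ℤ (b + + x) × (+ π j) ∣ℤ (b + + y) ×
    (∀ i → i ≢ j → ¬ ((+ π i) ∣ℤ (b + + x)) × ¬ ((+ π i) ∣ℤ (b + + y)))

  exclusivePair? : ∀ π b j x y → Dec (ExclusivePair π b j x y)
  exclusivePair? π b j x y = 1 ℕ.≤? x ×-dec x ℕ.<? y ×-dec y ℕ.≤? m ×-dec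
    π j ∣?ℤ (b + + x) ×-dec π j ∣?ℤ (b + + y) ×-dec
    all? (λ i → ¬? (i ≟ j) →-dec (¬? (π i ∣?ℤ (b + + x)) ×-dec ¬? (π i ∣?ℤ (b + + y))))

  TwiceExclusive : Family → ℤ → Fin (suc n) → Set
  TwiceExclusive π b j = ∃[ x ] ∃[ y ] ExclusivePair π b j x y

  twiceExclusive? : ∀ π b j → Dec (TwiceExclusive π b j)
  twiceExclusive? π b j =
    map′ forget bound (anyUpTo? (λ x → anyUpTo? (exclusivePair? π b j x) (suc m)) (suc m))
    where
    Bounded : Set
    Bounded = ∃[ x ] (x < suc m × ∃[ y ] (y < suc m × ExclusivePair π b j x y))
    forget : Bounded → TwiceExclusive π b j
    forget (x , _ , y , _ , pair) = x , y , pair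
    bound : TwiceExclusive π b j → Bounded
    bound (x , y , pair@(_ , x<y , y≤m , _)) = x , s≤s (≤-trans (<⇒≤ x<y) y≤m) , y , s≤s y≤m , pair

  AtMostOneExclusive : Family → ℤ → Fin (suc n) → Set
  AtMostOneExclusive π b j = ∀ x y → 1 ≤ x → x ≤ m → 1 ≤ y → y ≤ m →
    (+ π j) ∣ℤ (b + + x) → Exclusive π b j x → (+ π j) ∣ℤ (b + + y) → Exclusive π b j y → x ≡ y

  ¬twice⇒atMostOne : ∀ (π : Family) b j → ¬ TwiceExclusive π b j → AtMostOneExclusive π b j
  ¬twice⇒atMostOne π b j ¬twice x y 1≤x x≤m 1≤y y≤m dx ex dy ey with <-cmp x y
  ... | tri< x<y _ _ = contradiction (x , y , 1≤x , x<y , y≤m , dx , dy , λ i i≢j → ex i i≢j , ey i i≢j) ¬twice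
  ... | tri≈ _ x≡y _ = x≡y
  ... | tri> _ _ y<x = contradiction (y , x , 1≤y , y<x , x≤m , dy , dx , λ i i≢j → ey i i≢j , ex i i≢j) ¬twice

  exchange-distinct : ∀ (π : Family) j {q} → DistinctOddPrimes π → OddPrime q → (∀ i → π i ≢ q) →
                      DistinctOddPrimes (updateAt π j (const q))
  exchange-distinct π j {q} (inj , odd) oq fresh = inj′ , odd′
    where
    π′ : Family
    π′ = updateAt π j (const q)
    view : ∀ i → (i ≡ j × π′ i ≡ q) ⊎ (i ≢ j × π′ i ≡ π i)
    view i with i ≟ j
    ... | yes refl = inj₁ (refl , updateAt-updates j {const q} π)
    ... | no i≢j   = inj₂ (i≢j , updateAt-minimal i j {const q} π i≢j)
    inj′ : Injective _≡_ _≡_ π′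
    inj′ {i} {i′} π′i≡π′i′ with view i | view i′
    ... | inj₁ (refl , _) | inj₁ (refl , _) = refl
    ... | inj₁ (_ , e)    | inj₂ (_ , e′)   = contradiction (trans (sym e′) (trans (sym π′i≡π′i′) e)) (fresh i′)
    ... | inj₂ (_ , e)    | inj₁ (_ , e′)   = contradiction (trans (sym e) (trans π′i≡π′i′ e′)) (fresh i)
    ... | inj₂ (_ , e)    | inj₂ (_ , e′)   = inj (trans (sym e) (trans π′i≡π′i′ e′))
    odd′ : ∀ i → OddPrime (π′ i)
    odd′ i with view i
    ... | inj₁ (_ , e) = subst OddPrime (sym e) oq
    ... | inj₂ (_ , e) = subst OddPrime (sym e) (odd i)

  -- Exchanging π_j for any prime q ∤ P = cofactor π j keeps a covering, after
  -- shifting b by a suitable multiple of P, as long as π_j covers at most one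
  -- position exclusively: that position is given to q, all others keep a cover.
  exchange-covers : ∀ (π : Family) b j {q} → Covers π b m → AtMostOneExclusive π b j →
                    Prime q → ¬ q ∣ℕ cofactor π j →
                    ∃[ t ] Covers (updateAt π j (const q)) (b + t * + cofactor π j) m
  exchange-covers π b j {q} cov atMostOne pq q∤P = t , cov′
    where
    P : ℕ
    P = cofactor π j
    -- choose t so that q divides the position covered by π_j alone, if any
    retarget : ∃[ t ] (∀ x → 1 ≤ x → x ≤ m → (+ π j) ∣ℤ (b + + x) → Exclusive π b j x →
                          (+ q) ∣ℤ ((b + t * + P) + + x))
    retarget with anyUpTo? (λ x → 1 ℕ.≤? x ×-dec π j ∣?ℤ (b + + x) ×-dec exclusive? π b j x) (suc m)
    ... | no none = + 0 , λ x 1≤x x≤m dx ex → ⊥-elim (none (x , s≤s x≤m , 1≤x , dx , ex))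
    ... | yes (x₀ , x₀<1+m , 1≤x₀ , dx₀ , ex₀) =
      let t , q∣ = solveCongruence pq q∤P (b + + x₀) in
      t , λ x 1≤x x≤m dx ex →
        subst (λ z → (+ q) ∣ℤ ((b + t * + P) + + z))
              (atMostOne x₀ x 1≤x₀ (≤-pred x₀<1+m) 1≤x x≤m dx₀ ex₀ dx ex)
          (Signed.∣⇒∣ᵤ (subst (+ q Signed.∣_) (shift-rearrange b t (+ P) (+ x₀)) q∣))
    t : ℤ
    t = proj₁ retarget
    b′ : ℤ
    b′ = b + t * + P
    π′ : Family
    π′ = updateAt π j (const q)
    keep : ∀ x i → i ≢ j → (+ π i) ∣ℤ (b + + x) → ∃[ i′ ] (+ π′ i′) ∣ℤ (b′ + + x)
    keep x i i≢j d = i , subst (λ p → (+ p) ∣ℤ (b′ + + x)) (sym (updateAt-minimal i j {const q} π i≢j))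
                              (shift-∣ b t x (∣cofactor π i≢j) d)
    cov′ : Covers π′ b′ m
    cov′ x 1≤x x≤m with i , d ← cov x 1≤x x≤m with i ≟ j
    ... | no i≢j = keep x i i≢j d
    ... | yes refl with any? (λ i′ → ¬? (i′ ≟ i) ×-dec π i′ ∣?ℤ (b + + x))
    ...   | yes (i′ , i′≢j , d′) = keep x i′ i′≢j d′
    ...   | no none = j , subst (λ p → (+ p) ∣ℤ (b′ + + x)) (sym (updateAt-updates j {const q} π))
                            (proj₂ retarget x 1≤x x≤m d (λ i′ i′≢j d′ → none (i′ , i′≢j , d′)))

  Big : Family → Fin (suc n) → Set
  Big π j = ∃[ pk ] (pk < π j × IsKthPrime (suc (suc n)) pk)

  big? : ∀ π j → Dec (Big π j)
  big? π j = anyUpTo? (λ pk → prime? pk ×-dec (primeCount pk ℕ.≟ suc (suc n))) (π j)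

  fresh-below : ∀ (π : Family) j {q} → q < π j → (∀ i → removeAt π j i ≢ q) → ∀ i → π i ≢ q
  fresh-below π j {q} q<πj q∉others i with i ≟ j
  ... | yes refl = <⇒≢ q<πj ∘ sym
  ... | no i≢j   = subst (_≢ q) (cong π (punchIn-punchOut (i≢j ∘ sym))) (q∉others (punchOut (i≢j ∘ sym)))

  improve : ∀ (π : Family) b j → DistinctOddPrimes π → Covers π b m → Big π j → ¬ TwiceExclusive π b j →
            ∃[ b′ ] Σ Family (λ π′ → total π′ < total π × DistinctOddPrimes π′ × Covers π′ b′ m)
  improve π b j dop cov (pk , pk<πj , _ , count) ¬twice
    with q , oq , q≤pk , q∉others ← missingOddPrime (removeAt π j) pk (≤-reflexive (sym count)) =
    let q<πj  = ≤-<-trans q≤pk pk<πj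
        fresh = fresh-below π j q<πj q∉others
        t , cov′ = exchange-covers π b j cov (¬twice⇒atMostOne π b j ¬twice) (proj₁ oq)
                     (fresh∤cofactor π j (proj₁ ∘ proj₂ dop) (proj₁ oq) fresh)
    in b + t * + cofactor π j , updateAt π j (const q) ,
       total-updateAt-< π j q<πj , exchange-distinct π j dop oq fresh , cov′

  balance : IsΩ (suc (suc n)) m → ∀ b (π : Family) → Acc _<_ (total π) →
            DistinctOddPrimes π → Covers π b m →
            ∃[ b′ ] Σ Family (λ π′ → DistinctOddPrimes π′ × Balanced (suc (suc n)) π′ b′ m)
  balance isΩ b π (acc smaller) dop cov with any? (λ j → big? π j ×-dec ¬? (twiceExclusive? π b j))
  ... | no noneBad = b , π , dop , cov , isΩ , λ j pk kth pk<πj →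
          decidable-stable (twiceExclusive? π b j) (λ ¬twice → noneBad (j , (pk , pk<πj , kth) , ¬twice))
  ... | yes (j , big , ¬twice) with b′ , π′ , decrease , dop′ , cov′ ← improve π b j dop cov big ¬twice =
          balance isΩ b′ π′ (smaller decrease) dop′ cov′

-- For k = n+2 the family is indexed by Fin (n+1); the hypothesis 3 ≤ k only
-- rules out k ≤ 1.
proposition1 : (k : ℕ) → 3 ≤ k → (m : ℕ) → IsΩ k m →
    (a : ℤ) (π : Fin (k ∸ 1) → ℕ) → DistinctOddPrimes π → Covers π a m →
    ∃[ b ] Σ (Fin (k ∸ 1) → ℕ) (λ π' → DistinctOddPrimes π' × Balanced k π' b m)
proposition1 (suc (suc n)) _ m isΩ a π dop cov = balance m isΩ a π (<-wellFounded (total π)) dop cov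
proposition1 (suc ℕ.zero) (s≤s ()) m isΩ a π dop cov
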